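{- Let $n,m\ge 1$ be integers and let $\mathcal{F}\subseteq\{0,1,\ldots,m-1\}^n$ be a collection of $n$-tuples which does not contain two different tuples $(d_1,\ldots,d_n)$ and $(k_1,\ldots,k_n)$ such that $d_i<k_i$ for all $i\in\{1,\ldots,n\}$. Then $|\mathcal{F}|\le n\,m^{n-1}$. -}

module Defs where

open import Data.Nat using (ℕ)
open import Data.Fin using (Fin; _<_)
open import Data.Vec using (Vec; lookup)
open import Data.List using (List)
open import Data.List.Membership.Propositional using (_∈_)
open import Relation.Binary.PropositionalEquality using (_≡_)
open import Relation.Nullary using (¬_)

Tuple : ℕ → ℕ → Set
Tuple n m = Vec (Fin m) n

StrictlyBelow : ∀ {n m} → Tuple n m → Tuple n m → Set
StrictlyBelow {n} d k = (i : Fin n) → lookup d i < lookup k i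

NoStrictChain : ∀ {n m} → List (Tuple n m) → Set
NoStrictChain F = ∀ {d k} → d ∈ F → k ∈ F → ¬ (d ≡ k) → ¬ StrictlyBelow d k

module Submission where

-- Write a tuple d as  d = shape d + min d,  where
-- min d is its least entry and  shape d = d − min d  (coordinatewise) has
-- a zero at a position  argmin d  where the minimum is attained.  Two
-- tuples with the same shape differ by a constant shift, so they are
-- either equal or one is strictly below the other in every coordinate.
-- Hence, in a family F without strict chains, a tuple is determined by its
-- shape, and the shape is determined by the pair
--     (argmin d ,  shape d with coordinate argmin d deleted),
-- which ranges over  Fin n × Fin m ^ (n − 1),  a set of  n · m ^ (n − 1)
-- elements.

open import Defs
open import Data.Nat as ℕ using (ℕ; zero; suc; _≤_; _+_; _*_; _^_; _∸_; _≤?_)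
import Data.Nat.Properties as ℕ
open import Data.Fin as Fin using (Fin; zero; suc; toℕ; fromℕ<; combine; funToFin; finToFun)
import Data.Fin.Properties as Fin
open import Data.Vec using (Vec; []; _∷_; lookup; map; removeAt; insertAt)
open import Data.Vec.Properties using (lookup-map; insertAt-removeAt)
open import Data.Vec.Relation.Binary.Pointwise.Extensional using (ext; Pointwise-≡⇒≡)
open import Data.List as List using (List; length)
open import Data.List.Relation.Unary.Unique.Propositional using (Unique)
open import Data.List.Relation.Unary.AllPairs using (_∷_)
import Data.List.Relation.Unary.All as All
open import Data.List.Membership.Propositional using (_∈_)
open import Data.List.Membership.Propositional.Properties using (∈-lookup)
open import Data.Product using (_,_)
open import Data.Sum using (_⊎_; inj₁; inj₂)
open import Function using (_∘_)
open import Relation.Binary.Definitions using (tri<; tri≈; tri>)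
open import Relation.Binary.PropositionalEquality
open import Relation.Nullary using (¬_; yes; no; contradiction)

unique-lookup-distinct : ∀ {A : Set} {xs : List A} → Unique xs →
  ∀ {i j} → i Fin.< j → List.lookup xs i ≢ List.lookup xs j
unique-lookup-distinct (x∉xs ∷ _)  {zero}  {suc j} _         = All.lookup x∉xs (∈-lookup j)
unique-lookup-distinct (_ ∷ uniq)  {suc i} {suc j} (ℕ.s≤s i<j) = unique-lookup-distinct uniq i<j

unique-length-≤ : ∀ {A : Set} {k} {xs : List A} → Unique xs → (f : A → Fin k) →
  (∀ {x y} → x ∈ xs → y ∈ xs → f x ≡ f y → x ≡ y) → length xs ≤ k
unique-length-≤ {k = k} {xs} uniq f f-inj with length xs ≤? k
... | yes fits = fits
... | no tooLong with Fin.pigeonhole (ℕ.≰⇒> tooLong) (f ∘ List.lookup xs)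
...   | i , j , i<j , collision =
  contradiction (f-inj (∈-lookup i) (∈-lookup j) collision) (unique-lookup-distinct uniq i<j)

argmin : ∀ {n m} → Tuple (suc n) m → Fin (suc n)
argmin (x ∷ [])     = zero
argmin (x ∷ y ∷ ys) with toℕ x ≤? toℕ (lookup (y ∷ ys) (argmin (y ∷ ys)))
... | yes _ = zero
... | no _  = suc (argmin (y ∷ ys))

minimum : ∀ {n m} → Tuple (suc n) m → ℕ
minimum d = toℕ (lookup d (argmin d))

minimum-≤ : ∀ {n m} (d : Tuple (suc n) m) (j : Fin (suc n)) → minimum d ≤ toℕ (lookup d j)
minimum-≤ (x ∷ [])     zero = ℕ.≤-refl
minimum-≤ (x ∷ y ∷ ys) j with toℕ x ≤? toℕ (lookup (y ∷ ys) (argmin (y ∷ ys)))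
minimum-≤ (x ∷ y ∷ ys) zero    | yes x≤min = ℕ.≤-refl
minimum-≤ (x ∷ y ∷ ys) (suc j) | yes x≤min = ℕ.≤-trans x≤min (minimum-≤ (y ∷ ys) j)
minimum-≤ (x ∷ y ∷ ys) zero    | no  x≰min = ℕ.<⇒≤ (ℕ.≰⇒> x≰min)
minimum-≤ (x ∷ y ∷ ys) (suc j) | no  x≰min = minimum-≤ (y ∷ ys) j

_⊖_ : ∀ {m} → Fin m → ℕ → Fin m
x ⊖ a = fromℕ< (ℕ.≤-<-trans (ℕ.m∸n≤m (toℕ x) a) (Fin.toℕ<n x))

shape : ∀ {n m} → Tuple (suc n) m → Tuple (suc n) m
shape d = map (_⊖ minimum d) d

toℕ-shape : ∀ {n m} (d : Tuple (suc n) m) j →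
  toℕ (lookup (shape d) j) ≡ toℕ (lookup d j) ∸ minimum d
toℕ-shape d j = trans (cong toℕ (lookup-map j (_⊖ minimum d) d)) (Fin.toℕ-fromℕ< _)

shape-argmin : ∀ {n m} (d : Tuple (suc n) m) → toℕ (lookup (shape d) (argmin d)) ≡ 0
shape-argmin d = trans (toℕ-shape d (argmin d)) (ℕ.n∸n≡0 (minimum d))

shape-decomposition : ∀ {n m} (d : Tuple (suc n) m) j →
  toℕ (lookup d j) ≡ toℕ (lookup (shape d) j) + minimum d
shape-decomposition d j = begin
  toℕ (lookup d j)                        ≡⟨ ℕ.m∸n+n≡m (minimum-≤ d j) ⟨
  toℕ (lookup d j) ∸ minimum d + minimum d ≡⟨ cong (_+ minimum d) (toℕ-shape d j) ⟨
  toℕ (lookup (shape d) j) + minimum d    ∎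
  where open ≡-Reasoning

shifted-below : ∀ {n m} (d e : Tuple (suc n) m) → shape d ≡ shape e →
  minimum d ℕ.< minimum e → StrictlyBelow d e
shifted-below d e same min< j rewrite shape-decomposition d j | shape-decomposition e j | same =
  ℕ.+-monoʳ-< (toℕ (lookup (shape e) j)) min<

same-shape-trichotomy : ∀ {n m} (d e : Tuple (suc n) m) → shape d ≡ shape e →
  d ≡ e ⊎ StrictlyBelow d e ⊎ StrictlyBelow e d
same-shape-trichotomy d e same with ℕ.<-cmp (minimum d) (minimum e)
... | tri< min< _ _ = inj₂ (inj₁ (shifted-below d e same min<))
... | tri> _ _ min> = inj₂ (inj₂ (shifted-below e d (sym same) min>))
... | tri≈ _ min≡ _ = inj₁ (Pointwise-≡⇒≡ (ext λ j → Fin.toℕ-injective (begin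
  toℕ (lookup d j)                     ≡⟨ shape-decomposition d j ⟩
  toℕ (lookup (shape d) j) + minimum d ≡⟨ cong₂ (λ s μ → toℕ (lookup s j) + μ) same min≡ ⟩
  toℕ (lookup (shape e) j) + minimum e ≡⟨ shape-decomposition e j ⟨
  toℕ (lookup e j)                     ∎)))
  where open ≡-Reasoning

strictlyBelow-irrefl : ∀ {n m} (d : Tuple (suc n) m) → ¬ StrictlyBelow d d
strictlyBelow-irrefl d below = ℕ.<-irrefl refl (below zero)

removeAt-injective : ∀ {A : Set} {n} (xs ys : Vec A (suc n)) (i : Fin (suc n)) →
  lookup xs i ≡ lookup ys i → removeAt xs i ≡ removeAt ys i → xs ≡ ys
removeAt-injective xs ys i same-at same-rest = begin
  xs                                        ≡⟨ insertAt-removeAt xs i ⟨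
  insertAt (removeAt xs i) i (lookup xs i) ≡⟨ cong₂ (λ r x → insertAt r i x) same-rest same-at ⟩
  insertAt (removeAt ys i) i (lookup ys i) ≡⟨ insertAt-removeAt ys i ⟩
  ys                                        ∎
  where open ≡-Reasoning

encode : ∀ {k m} → Tuple k m → Fin (m ^ k)
encode v = funToFin (lookup v)

encode-injective : ∀ {k m} (v w : Tuple k m) → encode v ≡ encode w → v ≡ w
encode-injective v w same = Pointwise-≡⇒≡ (ext λ j → begin
  lookup v j                    ≡⟨ Fin.finToFun-funToFin (lookup v) j ⟨
  finToFun (encode v) j         ≡⟨ cong (λ c → finToFun c j) same ⟩
  finToFun (encode w) j         ≡⟨ Fin.finToFun-funToFin (lookup w) j ⟩
  lookup w j                    ∎)
  where open ≡-Reasoning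

signature : ∀ {n m} → Tuple (suc n) m → Fin (suc n * m ^ n)
signature d = combine (argmin d) (encode (removeAt (shape d) (argmin d)))

-- The signature determines the shape, because the shape vanishes at the
-- position of the minimum.
signature-shape : ∀ {n m} (d e : Tuple (suc n) m) → signature d ≡ signature e → shape d ≡ shape e
signature-shape d e same with Fin.combine-injective (argmin d) _ (argmin e) _ same
... | same-argmin , same-code = removeAt-injective (shape d) (shape e) (argmin d)
  (Fin.toℕ-injective (trans (shape-argmin d) (sym zero-at-argmin)))
  (trans (encode-injective _ _ same-code) (cong (removeAt (shape e)) (sym same-argmin)))
  where
  zero-at-argmin : toℕ (lookup (shape e) (argmin d)) ≡ 0
  zero-at-argmin = trans (cong (toℕ ∘ lookup (shape e)) same-argmin) (shape-argmin e)

signature-injective : ∀ {n m} {F : List (Tuple (suc n) m)} → NoStrictChain F →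
  ∀ {d e} → d ∈ F → e ∈ F → signature d ≡ signature e → d ≡ e
signature-injective noChain {d} {e} d∈F e∈F same
  with same-shape-trichotomy d e (signature-shape d e same)
... | inj₁ d≡e        = d≡e
... | inj₂ (inj₁ d<e) = contradiction d<e (noChain d∈F e∈F (λ { refl → strictlyBelow-irrefl d d<e }))
... | inj₂ (inj₂ e<d) = contradiction e<d (noChain e∈F d∈F (λ { refl → strictlyBelow-irrefl e e<d }))

-- For n = 1 + n', count F through the signature into Fin (n · m ^ n').
lemma2p1 : (n m : ℕ) → 1 ≤ n → 1 ≤ m → (F : List (Tuple n m)) → Unique F → NoStrictChain F →
    length F ≤ n * m ^ (n ∸ 1)
lemma2p1 zero    m () _
lemma2p1 (suc n) m _  _ F uniq noChain = unique-length-≤ uniq signature (signature-injective noChain)
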